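{- For every $m\ge1$, $\mathbf{PC}^=\vdash\forall\boldsymbol{\lambda}\mathbf I\to T\in H_{m+1}$.
   Context: Language: left-associative binary application symbol $\circ$ (juxtaposition), constants $S,B,C,I,p,q$, equality. $\boldsymbol{\lambda}\mathbf I$: equations $Sxyz=xz(yz)$, $Bxyz=x(yz)$, $Cxyz=xzy$, $Ix=x$; $\forall\boldsymbol{\lambda}\mathbf I$ is the set of their universal closures, and $\{A_1,\dots,A_m\}\to F$ means $A_1\to\dots\to A_m\to F$. $T:=SB(CBI)$. Membership abbreviations: $y\in H_1$ stands for $\forall z.\,pz=p(yz)$, and $y\in H_{m+1}$ stands for $\forall z.\,(z\in H_m\to yz\in H_m)$. $\mathbf{PC}^=$ is Hilbert-style classical predicate calculus with the equality axioms $t=t$, $s=t\to t=s$, $s=t\to t=u\to s=u$, $\vec s=\vec t\to f\vec s=f\vec t$, $\vec s=\vec t\to P\vec s\to P\vec t$. -}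

module Defs where

open import Data.Nat using (ℕ; zero; suc; pred; _<ᵇ_; _≡ᵇ_)
open import Data.Bool using (if_then_else_)
open import Data.List using (List; []; _∷_; foldr)

data Tm : Set where
  var : ℕ → Tm
  𝐒 𝐁 𝐂 𝐈 𝐩 𝐪 : Tm
  _·_ : Tm → Tm → Tm

infixl 9 _·_

-- Formulas: equality, falsum, implication, universal quantifier
-- (de Bruijn: ∀' binds index 0).  Other connectives are definable classically.
data Fm : Set where
  _≐_ : Tm → Tm → Fm
  ⊥' : Fm
  _⇒_ : Fm → Fm → Fm
  ∀' : Fm → Fm

infix 6 _≐_
infixr 4 _⇒_

shiftT : ℕ → Tm → Tm
shiftT c (var i) = if i <ᵇ c then var i else var (suc i)
shiftT c 𝐒 = 𝐒
shiftT c 𝐁 = 𝐁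
shiftT c 𝐂 = 𝐂
shiftT c 𝐈 = 𝐈
shiftT c 𝐩 = 𝐩
shiftT c 𝐪 = 𝐪
shiftT c (s · t) = shiftT c s · shiftT c t

shiftF : ℕ → Fm → Fm
shiftF c (s ≐ t) = shiftT c s ≐ shiftT c t
shiftF c ⊥' = ⊥'
shiftF c (φ ⇒ ψ) = shiftF c φ ⇒ shiftF c ψ
shiftF c (∀' φ) = ∀' (shiftF (suc c) φ)

substT : ℕ → Tm → Tm → Tm
substT k t (var i) = if i <ᵇ k then var i else (if i ≡ᵇ k then t else var (pred i))
substT k t 𝐒 = 𝐒
substT k t 𝐁 = 𝐁
substT k t 𝐂 = 𝐂
substT k t 𝐈 = 𝐈
substT k t 𝐩 = 𝐩
substT k t 𝐪 = 𝐪
substT k t (u · v) = substT k t u · substT k t v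

substF : ℕ → Tm → Fm → Fm
substF k t (u ≐ v) = substT k t u ≐ substT k t v
substF k t ⊥' = ⊥'
substF k t (φ ⇒ ψ) = substF k t φ ⇒ substF k t ψ
substF k t (∀' φ) = ∀' (substF (suc k) (shiftT 0 t) φ)

inst : Fm → Tm → Fm
inst φ t = substF 0 t φ

-- Only function symbols: binary application (constants are nullary, their
-- congruence axiom is an instance of t = t); only predicate: equality.
data ⊢_ : Fm → Set where
  ax-K : ∀ φ ψ → ⊢ (φ ⇒ ψ ⇒ φ)
  ax-S : ∀ φ ψ χ → ⊢ ((φ ⇒ ψ ⇒ χ) ⇒ (φ ⇒ ψ) ⇒ φ ⇒ χ)
  ax-DN : ∀ φ → ⊢ (((φ ⇒ ⊥') ⇒ ⊥') ⇒ φ)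
  ax-inst : ∀ φ t → ⊢ (∀' φ ⇒ inst φ t)
  ax-vac : ∀ φ → ⊢ (φ ⇒ ∀' (shiftF 0 φ))
  ax-dist : ∀ φ ψ → ⊢ (∀' (φ ⇒ ψ) ⇒ ∀' φ ⇒ ∀' ψ)
  eq-refl : ∀ t → ⊢ (t ≐ t)
  eq-sym : ∀ s t → ⊢ (s ≐ t ⇒ t ≐ s)
  eq-trans : ∀ s t u → ⊢ (s ≐ t ⇒ t ≐ u ⇒ s ≐ u)
  eq-app : ∀ s₁ s₂ t₁ t₂ → ⊢ (s₁ ≐ t₁ ⇒ s₂ ≐ t₂ ⇒ s₁ · s₂ ≐ t₁ · t₂)
  eq-pred : ∀ s₁ s₂ t₁ t₂ → ⊢ (s₁ ≐ t₁ ⇒ s₂ ≐ t₂ ⇒ s₁ ≐ s₂ ⇒ t₁ ≐ t₂)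
  mp : ∀ {φ ψ} → ⊢ (φ ⇒ ψ) → ⊢ φ → ⊢ ψ
  gen : ∀ {φ} → ⊢ φ → ⊢ ∀' φ

#0 #1 #2 : Tm
#0 = var 0
#1 = var 1
#2 = var 2

-- ∀λI: universal closures of the λI equations
-- ∀x∀y∀z. Sxyz = xz(yz)   (x = #2, y = #1, z = #0)
ax𝐒 ax𝐁 ax𝐂 ax𝐈 : Fm
ax𝐒 = ∀' (∀' (∀' (𝐒 · #2 · #1 · #0 ≐ #2 · #0 · (#1 · #0))))
ax𝐁 = ∀' (∀' (∀' (𝐁 · #2 · #1 · #0 ≐ #2 · (#1 · #0))))
ax𝐂 = ∀' (∀' (∀' (𝐂 · #2 · #1 · #0 ≐ #2 · #0 · #1)))
ax𝐈 = ∀' (𝐈 · #0 ≐ #0)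

∀λI : List Fm
∀λI = ax𝐒 ∷ ax𝐁 ∷ ax𝐂 ∷ ax𝐈 ∷ []

_⇒*_ : List Fm → Fm → Fm
As ⇒* F = foldr _⇒_ F As

𝐓 : Tm
𝐓 = 𝐒 · 𝐁 · (𝐂 · 𝐁 · 𝐈)

-- Membership: y ∈H[ n ] stands for  y ∈ H_{n+1}  (so index 0 is H_1).
--   y ∈ H_1      :=  ∀z. p z = p (y z)
--   y ∈ H_{m+1}  :=  ∀z. (z ∈ H_m → y z ∈ H_m)
-- (y is shifted when going under the binder, so the bound z is fresh.)
_∈H[_] : Tm → ℕ → Fm
y ∈H[ zero ] = ∀' (𝐩 · #0 ≐ 𝐩 · (shiftT 0 y · #0))
y ∈H[ suc n ] = ∀' ((#0 ∈H[ n ]) ⇒ ((shiftT 0 y · #0) ∈H[ n ]))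

module Submission where

-- T = SB(CBI) is the "twice" combinator: the λI equations prove T y z = y (y z).
-- The theorem is split along this observation.
--
--   (A) ∀λI ⊢ ∀y z. T y z = y (y z)                   (twiceLaw)
--   (B) ∀y z. T y z = y (y z) ⊢ T ∈ H_{n+2}  for every n   (𝐓∈H)
--
-- (B) is the heart: if y ∈ H_{k+1} then T y ∈ H_{k+1}.  For k = 0 this is
-- p z = p (y z) = p (y (y z)) = p (T y z); for larger k, z ∈ H_k gives
-- y (y z) ∈ H_k and membership is transported along T y z = y (y z).

open import Defs
open import Data.Nat using (ℕ; _≤_; zero; suc; _<ᵇ_; _≡ᵇ_)
open import Data.Bool using (true; false)
open import Data.List using (List; []; _∷_; map)
open import Relation.Binary.PropositionalEquality
  using (_≡_; refl; sym; trans; cong; cong₂; subst)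

shift-shift : ∀ c u → shiftT (suc c) (shiftT 0 u) ≡ shiftT 0 (shiftT c u)
shift-shift c (var i) with i <ᵇ c
... | true  = refl
... | false = refl
shift-shift c 𝐒 = refl
shift-shift c 𝐁 = refl
shift-shift c 𝐂 = refl
shift-shift c 𝐈 = refl
shift-shift c 𝐩 = refl
shift-shift c 𝐪 = refl
shift-shift c (s · t) = cong₂ _·_ (shift-shift c s) (shift-shift c t)

subst-shift : ∀ j t u → substT (suc j) (shiftT 0 t) (shiftT 0 u) ≡ shiftT 0 (substT j t u)
subst-shift zero    t (var zero) = refl
subst-shift (suc j) t (var zero) = refl
subst-shift j t (var (suc i)) with suc i <ᵇ j | suc i ≡ᵇ j
... | true  | _     = refl
... | false | true  = refl
... | false | false = refl
subst-shift j t 𝐒 = refl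
subst-shift j t 𝐁 = refl
subst-shift j t 𝐂 = refl
subst-shift j t 𝐈 = refl
subst-shift j t 𝐩 = refl
subst-shift j t 𝐪 = refl
subst-shift j t (s · u) = cong₂ _·_ (subst-shift j t s) (subst-shift j t u)

subst-shift-cancel : ∀ t u → substT 0 t (shiftT 0 u) ≡ u
subst-shift-cancel t (var i) = refl
subst-shift-cancel t 𝐒 = refl
subst-shift-cancel t 𝐁 = refl
subst-shift-cancel t 𝐂 = refl
subst-shift-cancel t 𝐈 = refl
subst-shift-cancel t 𝐩 = refl
subst-shift-cancel t 𝐪 = refl
subst-shift-cancel t (s · u) = cong₂ _·_ (subst-shift-cancel t s) (subst-shift-cancel t u)

subst-shift₂-cancel : ∀ x y z → substT 0 z (substT 1 (shiftT 0 y) (shiftT 0 (shiftT 0 x))) ≡ x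
subst-shift₂-cancel x y z =
  trans (cong (substT 0 z) (trans (subst-shift 0 y (shiftT 0 x))
                                  (cong (shiftT 0) (subst-shift-cancel y x))))
        (subst-shift-cancel z x)

shift-∈H : ∀ c u k → shiftF c (u ∈H[ k ]) ≡ (shiftT c u) ∈H[ k ]
shift-∈H c u zero = cong (λ w → ∀' (𝐩 · #0 ≐ 𝐩 · (w · #0))) (shift-shift c u)
shift-∈H c u (suc k) = cong₂ (λ a b → ∀' (a ⇒ b)) (shift-∈H (suc c) #0 k)
  (trans (shift-∈H (suc c) (shiftT 0 u · #0) k)
         (cong (λ w → (w · #0) ∈H[ k ]) (shift-shift c u)))

subst-∈H : ∀ j t u k → substF j t (u ∈H[ k ]) ≡ (substT j t u) ∈H[ k ]
subst-∈H j t u zero = cong (λ w → ∀' (𝐩 · #0 ≐ 𝐩 · (w · #0))) (subst-shift j t u)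
subst-∈H j t u (suc k) = cong₂ (λ a b → ∀' (a ⇒ b)) (subst-∈H (suc j) (shiftT 0 t) #0 k)
  (trans (subst-∈H (suc j) (shiftT 0 t) (shiftT 0 u · #0) k)
         (cong (λ w → (w · #0) ∈H[ k ]) (subst-shift j t u)))

-- ctx (Aₙ ∷ … ∷ A₁ ∷ []) φ = A₁ ⇒ … ⇒ Aₙ ⇒ φ ; the head is the latest hypothesis.
ctx : List Fm → Fm → Fm
ctx []      φ = φ
ctx (A ∷ Γ) φ = ctx Γ (A ⇒ φ)

record _⊩_ (Γ : List Fm) (φ : Fm) : Set where
  constructor ⟨_⟩
  field un : ⊢ ctx Γ φ
open _⊩_

infix 2 _⊩_

self-implies : ∀ φ → ⊢ (φ ⇒ φ)
self-implies φ = mp (mp (ax-S φ (φ ⇒ φ) φ) (ax-K φ (φ ⇒ φ))) (ax-K φ φ)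

thm : ∀ {Γ φ} → ⊢ φ → Γ ⊩ φ
thm {[]}    p = ⟨ p ⟩
thm {A ∷ Γ} {φ} p = ⟨ un (thm {Γ} (mp (ax-K φ A) p)) ⟩

mpC : ∀ {Γ φ ψ} → Γ ⊩ (φ ⇒ ψ) → Γ ⊩ φ → Γ ⊩ ψ
mpC {[]}    p q = ⟨ mp (un p) (un q) ⟩
mpC {A ∷ Γ} {φ} {ψ} p q =
  ⟨ un (mpC {Γ} (mpC {Γ} (thm (ax-S A φ ψ)) ⟨ un p ⟩) ⟨ un q ⟩) ⟩

hyp : ∀ {Γ A} → (A ∷ Γ) ⊩ A
hyp {Γ} {A} = ⟨ un (thm {Γ} (self-implies A)) ⟩

weaken : ∀ {Γ A φ} → Γ ⊩ φ → (A ∷ Γ) ⊩ φ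
weaken {A = A} {φ} p = ⟨ un (mpC (thm (ax-K φ A)) p) ⟩

deduce : ∀ {Γ A φ} → (A ∷ Γ) ⊩ φ → Γ ⊩ (A ⇒ φ)
deduce p = ⟨ un p ⟩

cut : ∀ {Γ A φ} → (A ∷ []) ⊩ φ → Γ ⊩ A → Γ ⊩ φ
cut p q = mpC (thm (un p)) q

-- ∀-introduction: a fresh variable 0 is available once Γ is shifted past it.
generalize : ∀ {Γ φ} → map (shiftF 0) Γ ⊩ φ → Γ ⊩ ∀' φ
generalize {[]}    p = ⟨ gen (un p) ⟩
generalize {A ∷ Γ} {φ} p =
  mpC (weaken (mpC (thm (ax-dist (shiftF 0 A) φ)) (generalize {Γ} ⟨ un p ⟩)))
      (mpC (thm (ax-vac A)) hyp)

-- ∀-elimination, with the instance given up to a syntactic identity.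
instantiate : ∀ {Γ φ ψ} → Γ ⊩ ∀' φ → ∀ t → inst φ t ≡ ψ → Γ ⊩ ψ
instantiate {φ = φ} p t refl = mpC (thm (ax-inst φ t)) p

instantiate₃ : ∀ {Γ φ ψ} → Γ ⊩ ∀' (∀' (∀' φ)) → ∀ x y z →
  substF 0 z (substF 1 (shiftT 0 y) (substF 2 (shiftT 0 (shiftT 0 x)) φ)) ≡ ψ → Γ ⊩ ψ
instantiate₃ p x y z = instantiate (instantiate (instantiate p x refl) y refl) z

≐-refl : ∀ {Γ t} → Γ ⊩ t ≐ t
≐-refl {t = t} = thm (eq-refl t)

≐-sym : ∀ {Γ a b} → Γ ⊩ a ≐ b → Γ ⊩ b ≐ a
≐-sym {a = a} {b} p = mpC (thm (eq-sym a b)) p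

≐-trans : ∀ {Γ a b c} → Γ ⊩ a ≐ b → Γ ⊩ b ≐ c → Γ ⊩ a ≐ c
≐-trans {a = a} {b} {c} p q = mpC (mpC (thm (eq-trans a b c)) p) q

≐-cong : ∀ {Γ a b c d} → Γ ⊩ a ≐ b → Γ ⊩ c ≐ d → Γ ⊩ a · c ≐ b · d
≐-cong {a = a} {b} {c} {d} p q = mpC (mpC (thm (eq-app a c b d)) p) q

module ≐-Reasoning {Γ : List Fm} where
  infix  1 begin_
  infixr 2 _≐⟨_⟩_
  infix  3 _∎

  begin_ : ∀ {a b} → Γ ⊩ a ≐ b → Γ ⊩ a ≐ b
  begin p = p

  _≐⟨_⟩_ : ∀ a {b c} → Γ ⊩ a ≐ b → Γ ⊩ b ≐ c → Γ ⊩ a ≐ c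
  a ≐⟨ p ⟩ q = ≐-trans p q

  _∎ : ∀ a → Γ ⊩ a ≐ a
  a ∎ = ≐-refl

∈H₁-intro : ∀ {Γ} y → map (shiftF 0) Γ ⊩ 𝐩 · #0 ≐ 𝐩 · (shiftT 0 y · #0) → Γ ⊩ y ∈H[ zero ]
∈H₁-intro y = generalize

∈H-intro : ∀ {Γ k} y → map (shiftF 0) Γ ⊩ (#0 ∈H[ k ] ⇒ (shiftT 0 y · #0) ∈H[ k ]) →
           Γ ⊩ y ∈H[ suc k ]
∈H-intro y = generalize

∈H₁-elim : ∀ {Γ y} → Γ ⊩ y ∈H[ zero ] → ∀ t → Γ ⊩ 𝐩 · t ≐ 𝐩 · (y · t)
∈H₁-elim {y = y} p t =
  instantiate p t (cong (λ w → 𝐩 · t ≐ 𝐩 · (w · t)) (subst-shift-cancel t y))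

∈H-elim : ∀ {Γ y k t} → Γ ⊩ y ∈H[ suc k ] → Γ ⊩ t ∈H[ k ] → Γ ⊩ (y · t) ∈H[ k ]
∈H-elim {y = y} {k} {t} p q = mpC (instantiate p t instance-eq) q
  where
  instance-eq : inst (#0 ∈H[ k ] ⇒ (shiftT 0 y · #0) ∈H[ k ]) t ≡ (t ∈H[ k ] ⇒ (y · t) ∈H[ k ])
  instance-eq = cong₂ _⇒_ (subst-∈H 0 t #0 k)
    (trans (subst-∈H 0 t (shiftT 0 y · #0) k)
           (cong (λ w → (w · t) ∈H[ k ]) (subst-shift-cancel t y)))

under-binder : ∀ {Γ φ} y k → (shiftT 0 y ∈H[ k ] ∷ Γ) ⊩ φ → (shiftF 0 (y ∈H[ k ]) ∷ Γ) ⊩ φ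
under-binder {Γ} {φ} y k = subst (λ A → (A ∷ Γ) ⊩ φ) (sym (shift-∈H 0 y k))

-- Each H_k is closed under provable equality, by induction on k; the closed
-- form is needed so that the induction hypothesis can be used under binders.
∈H-transport⊢ : ∀ k a b → ⊢ (a ≐ b ⇒ a ∈H[ k ] ⇒ b ∈H[ k ])
∈H-transport : ∀ {Γ} k {a b} → Γ ⊩ a ≐ b → Γ ⊩ a ∈H[ k ] → Γ ⊩ b ∈H[ k ]

∈H-transport⊢ zero a b = un {[]} (deduce (deduce (∈H₁-intro b (under-binder a zero
  (≐-trans (∈H₁-elim hyp #0) (≐-cong ≐-refl (≐-cong (weaken hyp) ≐-refl)))))))
∈H-transport⊢ (suc k) a b = un {[]} (deduce (deduce (∈H-intro b (under-binder a (suc k) (deduce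
  (∈H-transport k (≐-cong (weaken (weaken hyp)) ≐-refl) (∈H-elim (weaken hyp) hyp)))))))

∈H-transport k {a} {b} p q = mpC (mpC (thm (∈H-transport⊢ k a b)) p) q

-- The hypotheses ∀λI, latest first: ctx λI-hyps φ is literally ∀λI ⇒* φ.
λI-hyps : List Fm
λI-hyps = ax𝐈 ∷ ax𝐂 ∷ ax𝐁 ∷ ax𝐒 ∷ []

S-rule : ∀ x y z → λI-hyps ⊩ 𝐒 · x · y · z ≐ x · z · (y · z)
S-rule x y z = instantiate₃ (weaken (weaken (weaken hyp))) x y z
  (cong₂ (λ X Y → 𝐒 · X · Y · z ≐ X · z · (Y · z))
         (subst-shift₂-cancel x y z) (subst-shift-cancel z y))

B-rule : ∀ x y z → λI-hyps ⊩ 𝐁 · x · y · z ≐ x · (y · z)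
B-rule x y z = instantiate₃ (weaken (weaken hyp)) x y z
  (cong₂ (λ X Y → 𝐁 · X · Y · z ≐ X · (Y · z))
         (subst-shift₂-cancel x y z) (subst-shift-cancel z y))

C-rule : ∀ x y z → λI-hyps ⊩ 𝐂 · x · y · z ≐ x · z · y
C-rule x y z = instantiate₃ (weaken hyp) x y z
  (cong₂ (λ X Y → 𝐂 · X · Y · z ≐ X · z · Y)
         (subst-shift₂-cancel x y z) (subst-shift-cancel z y))

I-rule : ∀ x → λI-hyps ⊩ 𝐈 · x ≐ x
I-rule x = instantiate hyp x refl

twice : ∀ y z → λI-hyps ⊩ 𝐓 · y · z ≐ y · (y · z)
twice y z =
  begin
    𝐓 · y · z                 ≐⟨ ≐-cong (S-rule 𝐁 (𝐂 · 𝐁 · 𝐈) y) ≐-refl ⟩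
    𝐁 · y · (𝐂 · 𝐁 · 𝐈 · y) · z ≐⟨ B-rule y (𝐂 · 𝐁 · 𝐈 · y) z ⟩
    y · (𝐂 · 𝐁 · 𝐈 · y · z)     ≐⟨ ≐-cong ≐-refl (≐-cong (C-rule 𝐁 𝐈 y) ≐-refl) ⟩
    y · (𝐁 · y · 𝐈 · z)         ≐⟨ ≐-cong ≐-refl (B-rule y 𝐈 z) ⟩
    y · (y · (𝐈 · z))           ≐⟨ ≐-cong ≐-refl (≐-cong ≐-refl (I-rule z)) ⟩
    y · (y · z)
  ∎
  where open ≐-Reasoning

TwiceLaw : Fm
TwiceLaw = ∀' (∀' (𝐓 · #1 · #0 ≐ #1 · (#1 · #0)))

twiceLaw : λI-hyps ⊩ TwiceLaw
twiceLaw = generalize (generalize (twice #1 #0))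

twice-elim : ∀ {Γ} → Γ ⊩ TwiceLaw → ∀ y z → Γ ⊩ 𝐓 · y · z ≐ y · (y · z)
twice-elim p y z = instantiate (instantiate p y refl) z
  (cong (λ w → 𝐓 · w · z ≐ w · (w · z)) (subst-shift-cancel z y))

T-preserves-H₁ : ∀ y z → (y ∈H[ zero ] ∷ TwiceLaw ∷ []) ⊩ 𝐩 · z ≐ 𝐩 · (𝐓 · y · z)
T-preserves-H₁ y z =
  begin
    𝐩 · z             ≐⟨ ∈H₁-elim hyp z ⟩
    𝐩 · (y · z)       ≐⟨ ∈H₁-elim hyp (y · z) ⟩
    𝐩 · (y · (y · z)) ≐⟨ ≐-cong ≐-refl (≐-sym (twice-elim (weaken hyp) y z)) ⟩
    𝐩 · (𝐓 · y · z)
  ∎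
  where open ≐-Reasoning

T-preserves-Hsuc : ∀ k y z → (z ∈H[ k ] ∷ y ∈H[ suc k ] ∷ TwiceLaw ∷ []) ⊩ (𝐓 · y · z) ∈H[ k ]
T-preserves-Hsuc k y z =
  ∈H-transport k (≐-sym (twice-elim (weaken (weaken hyp)) y z))
                 (∈H-elim (weaken hyp) (∈H-elim (weaken hyp) hyp))

T-preserves : ∀ k y → (y ∈H[ k ] ∷ TwiceLaw ∷ []) ⊩ (𝐓 · y) ∈H[ k ]
T-preserves zero y =
  ∈H₁-intro (𝐓 · y) (under-binder y zero (T-preserves-H₁ (shiftT 0 y) #0))
T-preserves (suc k) y =
  ∈H-intro (𝐓 · y) (under-binder y (suc k) (deduce (T-preserves-Hsuc k (shiftT 0 y) #0)))

𝐓∈H : ∀ n → (TwiceLaw ∷ []) ⊩ 𝐓 ∈H[ suc n ]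
𝐓∈H n = ∈H-intro 𝐓 (deduce (T-preserves n #0))

mainTheorem12 : ∀ (m : ℕ) → 1 ≤ m → ⊢ (∀λI ⇒* (𝐓 ∈H[ m ]))
mainTheorem12 zero    ()
mainTheorem12 (suc n) _ = un (cut (𝐓∈H n) twiceLaw)
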